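{- Let $\Pi$ be a projective plane of odd order $q$, with point set $\mathcal{P}$ and line set $\mathcal{L}$. Fix a point $P$ and $\frac{q+1}{2}$ distinct lines through $P$, and let $\mathcal{P}_1$ be the set of all points lying on at least one of these lines. Choose a line $\ell$ not incident with $P$ (so $|\ell\cap\mathcal{P}_1|=\frac{q+1}{2}$), and let $\mathcal{L}_1$ be the set of all lines incident with at least one point of $\ell\cap\mathcal{P}_1$. Let $A=\mathcal{P}_1\cup\mathcal{L}_1$ and $B=(\mathcal{P}\setminus\mathcal{P}_1)\cup(\mathcal{L}\setminus\mathcal{L}_1)$. Then $A\cup B$ is an internal partition of the point-line incidence graph of $\Pi$.
   Context: A projective plane of order $q$ is an incidence structure of points and lines in which any two points lie on a unique common line, any two lines meet in a unique point, every line has $q+1$ points and every point lies on $q+1$ lines. Its point-line incidence graph is the bipartite graph on the disjoint union of points and lines, with a point adjacent to a line iff incident. For a graph $G$, $d(v)$ denotes the degree of $v$ and $d_U(v)$ the number of neighbours of $v$ in $U$. An internal partition of $G$ is a partition $V(G)=A\cup B$ into two nonempty sets with $d_A(v)\ge d(v)/2$ for all $v\in A$ and $d_B(v)\ge d(v)/2$ for all $v\in B$. -}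

module Defs where

open import Data.Nat using (ℕ; _+_; _*_; _≤_)
open import Data.Nat as ℕ using ()
open import Data.Bool using (Bool; true; false; _∧_; _∨_; if_then_else_)
open import Data.Fin using (Fin; splitAt; zero; suc)
open import Data.Sum using (_⊎_; inj₁; inj₂)
open import Data.Product using (Σ; ∃; _×_; _,_)
open import Relation.Binary.PropositionalEquality using (_≡_; _≢_)

count : ∀ {n} → (Fin n → Bool) → ℕ
count {ℕ.zero}  f = 0
count {ℕ.suc n} f = (if f zero then 1 else 0) + count (λ i → f (suc i))

anyFin : ∀ {n} → (Fin n → Bool) → Bool
anyFin {ℕ.zero}  f = false
anyFin {ℕ.suc n} f = f zero ∨ anyFin (λ i → f (suc i))

record Graph (N : ℕ) : Set where
  field
    adj       : Fin N → Fin N → Bool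
    adj-sym   : ∀ u v → adj u v ≡ adj v u
    adj-irrefl : ∀ v → adj v v ≡ false

module _ {N : ℕ} (G : Graph N) where
  open Graph G

  deg : Fin N → ℕ
  deg v = count (adj v)

  degIn : (Fin N → Bool) → Fin N → ℕ
  degIn U v = count (λ u → adj v u ∧ U u)

  IsInternalPartition : (Fin N → Bool) → Set
  IsInternalPartition A =
    (∃ λ v → A v ≡ true) ×
    (∃ λ v → A v ≡ false) ×
    (∀ v → A v ≡ true  → deg v ≤ 2 * degIn A v) ×
    (∀ v → A v ≡ false → deg v ≤ 2 * degIn (λ u → if A u then false else true) v)

record ProjectivePlane (q np nl : ℕ) : Set where
  field
    I : Fin np → Fin nl → Bool
    two-points : ∀ p p′ → p ≢ p′ →
      Σ (Fin nl) λ l → (I p l ≡ true × I p′ l ≡ true) ×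
        (∀ l′ → I p l′ ≡ true → I p′ l′ ≡ true → l′ ≡ l)
    two-lines : ∀ l l′ → l ≢ l′ →
      Σ (Fin np) λ p → (I p l ≡ true × I p l′ ≡ true) ×
        (∀ p′ → I p′ l ≡ true → I p′ l′ ≡ true → p′ ≡ p)
    line-size  : ∀ l → count (λ p → I p l) ≡ ℕ.suc q
    point-deg  : ∀ p → count (λ l → I p l) ≡ ℕ.suc q

module _ {q np nl : ℕ} (Π : ProjectivePlane q np nl) where
  open ProjectivePlane Π

  -- incidence graph on vertex set Fin (np + nl): the first np vertices are
  -- the points, the remaining nl vertices are the lines.
  incAdj : Fin (np + nl) → Fin (np + nl) → Bool
  incAdj x y with splitAt np x | splitAt np y
  ... | inj₁ p | inj₂ l = I p l
  ... | inj₂ l | inj₁ p = I p l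
  ... | inj₁ _ | inj₁ _ = false
  ... | inj₂ _ | inj₂ _ = false

  incAdj-sym : ∀ x y → incAdj x y ≡ incAdj y x
  incAdj-sym x y with splitAt np x | splitAt np y
  ... | inj₁ p | inj₂ l = _≡_.refl
  ... | inj₂ l | inj₁ p = _≡_.refl
  ... | inj₁ _ | inj₁ _ = _≡_.refl
  ... | inj₂ _ | inj₂ _ = _≡_.refl

  incAdj-irrefl : ∀ x → incAdj x x ≡ false
  incAdj-irrefl x with splitAt np x
  ... | inj₁ _ = _≡_.refl
  ... | inj₂ _ = _≡_.refl

  incidenceGraph : Graph (np + nl)
  incidenceGraph = record { adj = incAdj ; adj-sym = incAdj-sym ; adj-irrefl = incAdj-irrefl }

  vertexSet : (Fin np → Bool) → (Fin nl → Bool) → Fin (np + nl) → Bool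
  vertexSet S T x with splitAt np x
  ... | inj₁ p = S p
  ... | inj₂ l = T l

-- Write q = 2k + 1, so every vertex of the incidence graph has degree 2k + 2 and needs k + 1
-- neighbours in its own part.  The main count is a perspectivity: for P ∉ m, meeting m with
-- the lines through P is a bijection, so m contains exactly k + 1 points of P₁; dually, a
-- point p ∉ ℓ lies on at least k + 1 lines joining it to ℓ ∩ P₁ (all in L₁) and on at least
-- k + 1 lines joining it to ℓ ∖ P₁ (none in L₁).  On the lines through P, membership in L₁
-- coincides with membership in S, and a line of L₁ other than ℓ meets ℓ in a point of P₁; so
-- a line through P or a point of ℓ has all, or all but one, of its neighbours in its own part.
module Submission where

open import Defs
open import Data.Nat using (ℕ; zero; suc; _+_; _*_; _≤_; _<_; z≤n; s≤s)
open import Data.Nat.Properties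
  using ( ≤-trans; ≤-reflexive; +-suc; +-assoc; +-identityʳ; +-cancelˡ-≤; +-monoˡ-≤; *-suc; *-monoʳ-≤
        ; m≤m+n; module ≤-Reasoning)
open import Data.Nat.Tactic.RingSolver using (solve-∀)
open import Data.Bool using (Bool; true; false; _∧_; not; if_then_else_)
open import Data.Bool.Properties using (∧-identityʳ; ∧-zeroʳ; ∧-conicalˡ; ∧-conicalʳ; ¬-not; not-¬)
open import Data.Fin using (Fin; zero; suc; _↑ˡ_; _↑ʳ_; splitAt)
open import Data.Fin.Properties
  using (_≟_; suc-injective; splitAt-↑ˡ; splitAt-↑ʳ; splitAt⁻¹-↑ˡ; splitAt⁻¹-↑ʳ)
open import Data.Sum using (inj₁; inj₂)
open import Data.Product using (∃; _×_; _,_; proj₁; proj₂)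
open import Function using (_∘_)
open import Relation.Nullary using (yes; no; does; contradiction)
open import Relation.Binary.PropositionalEquality

separated⇒≢ : ∀ {A : Set} (f : A → Bool) {x y} → f x ≡ true → f y ≡ false → x ≢ y
separated⇒≢ f fx fy refl = not-¬ fx fy

not-≡-true : ∀ {b} → b ≢ true → not b ≡ true
not-≡-true b≢true = sym (¬-not (b≢true ∘ sym))

not-≡-true⇒≡-false : ∀ {b} → not b ≡ true → b ≡ false
not-≡-true⇒≡-false {false} _ = refl

if-then-false-else-true≡not : ∀ b → (if b then false else true) ≡ not b
if-then-false-else-true≡not true  = refl
if-then-false-else-true≡not false = refl

order≡twice : ∀ k → suc (1 + 2 * k) ≡ suc k + suc k
order≡twice = solve-∀

majority : ∀ {k c} → suc k ≤ c → suc (1 + 2 * k) ≤ 2 * c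
majority {k} {c} k<c = subst (_≤ 2 * c) (*-suc 2 k) (*-monoʳ-≤ 2 k<c)

anyFin⁺ : ∀ {n} (f : Fin n → Bool) i → f i ≡ true → anyFin f ≡ true
anyFin⁺ f zero    fi rewrite fi = refl
anyFin⁺ f (suc i) fi with f zero
... | true  = refl
... | false = anyFin⁺ (f ∘ suc) i fi

anyFin⁻ : ∀ {n} (f : Fin n → Bool) → anyFin f ≡ true → ∃ λ i → f i ≡ true
anyFin⁻ {suc n} f any with f zero in f0
... | true  = zero , f0
... | false with anyFin⁻ (f ∘ suc) any
...   | i , fi = suc i , fi

count-cong : ∀ {n} {f g : Fin n → Bool} → (∀ i → f i ≡ g i) → count f ≡ count g
count-cong {zero}  f≗g = refl
count-cong {suc n} f≗g =
  cong₂ _+_ (cong (λ b → if b then 1 else 0) (f≗g zero)) (count-cong (f≗g ∘ suc))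

count-false : ∀ {n} → count {n} (λ _ → false) ≡ 0
count-false {zero}  = refl
count-false {suc n} = count-false {n}

count-+ : ∀ {a b} (f : Fin (a + b) → Bool) →
  count f ≡ count (λ i → f (i ↑ˡ b)) + count (λ j → f (a ↑ʳ j))
count-+ {zero}      f = refl
count-+ {suc a} {b} f = trans (cong (b₀ +_) (count-+ {a} {b} (f ∘ suc))) (sym (+-assoc b₀ _ _))
  where
    b₀ : ℕ
    b₀ = if f zero then 1 else 0

count-witness : ∀ {n} (f : Fin n → Bool) → 0 < count f → ∃ λ i → f i ≡ true
count-witness {suc n} f pos with f zero in f0
... | true  = zero , f0
... | false with count-witness (f ∘ suc) pos
...   | i , fi = suc i , fi

count-∧-not : ∀ {n} (f g : Fin n → Bool) →
  count f ≡ count (λ i → f i ∧ g i) + count (λ i → f i ∧ not (g i))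
count-∧-not {zero}  f g = refl
count-∧-not {suc n} f g with f zero | g zero
... | false | _     = count-∧-not (f ∘ suc) (g ∘ suc)
... | true  | true  = cong suc (count-∧-not (f ∘ suc) (g ∘ suc))
... | true  | false = trans (cong suc (count-∧-not (f ∘ suc) (g ∘ suc))) (sym (+-suc _ _))

count-∧-not-≥ : ∀ {n a b} (f g : Fin n → Bool) → count f ≡ a + b →
  count (λ i → f i ∧ g i) ≤ a → b ≤ count (λ i → f i ∧ not (g i))
count-∧-not-≥ {a = a} {b} f g ∣f∣ few = +-cancelˡ-≤ a b _ (begin
  a + b                                                          ≡⟨ sym ∣f∣ ⟩
  count f                                                        ≡⟨ count-∧-not f g ⟩
  count (λ i → f i ∧ g i) + count (λ i → f i ∧ not (g i))        ≤⟨ +-monoˡ-≤ _ few ⟩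
  a + count (λ i → f i ∧ not (g i))                              ∎)
  where open ≤-Reasoning

_without_ : ∀ {n} → (Fin n → Bool) → Fin n → Fin n → Bool
(f without j) i = f i ∧ not (does (i ≟ j))

count-without : ∀ {n} (f : Fin n → Bool) {j} → f j ≡ true → count f ≡ suc (count (f without j))
count-without f {zero} fj rewrite fj = cong suc (count-cong λ i → sym (∧-identityʳ (f (suc i))))
count-without f {suc j} fj with f zero
... | true  = cong suc (count-without (f ∘ suc) fj)
... | false = count-without (f ∘ suc) fj

count-injection-≤ : ∀ {n m} (f : Fin n → Bool) (g : Fin m → Bool) (φ : ∀ i → f i ≡ true → Fin m) →
  (∀ i fi → g (φ i fi) ≡ true) → (∀ i j fi fj → φ i fi ≡ φ j fj → i ≡ j) → count f ≤ count g
count-injection-≤ {zero}  f g φ φ∈g φ-inj = z≤n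
count-injection-≤ {suc n} {m} f g φ φ∈g φ-inj with f zero in f0
... | false = count-injection-≤ (f ∘ suc) g (φ ∘ suc) (φ∈g ∘ suc)
                (λ i j fi fj → suc-injective ∘ φ-inj _ _ fi fj)
... | true  = begin
  suc (count (f ∘ suc))                ≤⟨ s≤s (count-injection-≤ (f ∘ suc) (g without j) (φ ∘ suc) φ∈g′
                                             (λ i i′ fi fi′ → suc-injective ∘ φ-inj _ _ fi fi′)) ⟩
  suc (count (g without j))            ≡⟨ sym (count-without g (φ∈g zero f0)) ⟩
  count g                              ∎
  where
    open ≤-Reasoning
    j : Fin m
    j = φ zero f0
    φ∈g′ : ∀ i fi → (g without j) (φ (suc i) fi) ≡ true
    φ∈g′ i fi with φ (suc i) fi ≟ j
    ... | yes φi≡j = contradiction (φ-inj _ _ fi f0 φi≡j) λ ()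
    ... | no  _    = cong₂ _∧_ (φ∈g (suc i) fi) refl

count-mono : ∀ {n} {f g : Fin n → Bool} → (∀ i → f i ≡ true → g i ≡ true) → count f ≤ count g
count-mono f⊆g = count-injection-≤ _ _ (λ i _ → i) f⊆g (λ _ _ _ _ i≡j → i≡j)

count-≤1 : ∀ {n} (f : Fin n → Bool) j → (∀ i → f i ≡ true → i ≡ j) → count f ≤ 1
count-≤1 f j only-j = count-injection-≤ f (λ (_ : Fin 1) → true) (λ _ _ → zero) (λ _ _ → refl)
  (λ i i′ fi fi′ _ → trans (only-j i fi) (sym (only-j i′ fi′)))

dual : ∀ {q np nl} → ProjectivePlane q np nl → ProjectivePlane q nl np
dual Π = record
  { I          = λ l p → I p l
  ; two-points = two-lines
  ; two-lines  = two-points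
  ; line-size  = point-deg
  ; point-deg  = line-size
  }
  where open ProjectivePlane Π

module _ {q np nl} (Π : ProjectivePlane q np nl) where
  open ProjectivePlane Π

  meet : ∀ l m → l ≢ m → Fin np
  meet l m l≢m = proj₁ (two-lines l m l≢m)

  meet-incidentˡ : ∀ l m l≢m → I (meet l m l≢m) l ≡ true
  meet-incidentˡ l m l≢m = proj₁ (proj₁ (proj₂ (two-lines l m l≢m)))

  meet-incidentʳ : ∀ l m l≢m → I (meet l m l≢m) m ≡ true
  meet-incidentʳ l m l≢m = proj₂ (proj₁ (proj₂ (two-lines l m l≢m)))

  meet-unique : ∀ {l m x y} → l ≢ m →
    I x l ≡ true → I x m ≡ true → I y l ≡ true → I y m ≡ true → x ≡ y
  meet-unique l≢m xl xm yl ym with two-lines _ _ l≢m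
  ... | _ , _ , unique = trans (unique _ xl xm) (sym (unique _ yl ym))

module _ {q np nl} (Π : ProjectivePlane q np nl) where
  open ProjectivePlane Π

  join-unique : ∀ {p x l m} → p ≢ x →
    I p l ≡ true → I x l ≡ true → I p m ≡ true → I x m ≡ true → l ≡ m
  join-unique = meet-unique (dual Π)

  lines-through-point≤points-on-line : ∀ {P m} → I P m ≡ false → (R : Fin nl → Bool) (Q : Fin np → Bool) →
    (∀ s x → I P s ≡ true → R s ≡ true → I x m ≡ true → I x s ≡ true → Q x ≡ true) →
    count (λ s → I P s ∧ R s) ≤ count (λ x → I x m ∧ Q x)
  lines-through-point≤points-on-line {P} {m} P∉m R Q RQ =
    count-injection-≤ (λ s → I P s ∧ R s) (λ x → I x m ∧ Q x) φ φ-good φ-injective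
    where
      s≢m : ∀ s → I P s ∧ R s ≡ true → s ≢ m
      s≢m s h = separated⇒≢ (I P) (∧-conicalˡ _ _ h) P∉m
      φ : ∀ s → I P s ∧ R s ≡ true → Fin np
      φ s h = meet Π s m (s≢m s h)
      φ∈s : ∀ s h → I (φ s h) s ≡ true
      φ∈s s h = meet-incidentˡ Π s m (s≢m s h)
      φ∈m : ∀ s h → I (φ s h) m ≡ true
      φ∈m s h = meet-incidentʳ Π s m (s≢m s h)
      φ-good : ∀ s h → I (φ s h) m ∧ Q (φ s h) ≡ true
      φ-good s h = cong₂ _∧_ (φ∈m s h)
        (RQ s (φ s h) (∧-conicalˡ _ _ h) (∧-conicalʳ _ _ h) (φ∈m s h) (φ∈s s h))
      φ-injective : ∀ s t hs ht → φ s hs ≡ φ t ht → s ≡ t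
      φ-injective s t hs ht φs≡φt =
        join-unique (≢-sym (separated⇒≢ (λ x → I x m) (φ∈m s hs) P∉m))
          (∧-conicalˡ _ _ hs) (φ∈s s hs)
          (∧-conicalˡ _ _ ht) (subst (λ x → I x t ≡ true) (sym φs≡φt) (φ∈s t ht))

module _ {q np nl} (Π : ProjectivePlane q np nl) where
  open ProjectivePlane Π

  points-on-line≤lines-through-point : ∀ {p ℓ} → I p ℓ ≡ false → (R : Fin np → Bool) (Q : Fin nl → Bool) →
    (∀ x l → I x ℓ ≡ true → R x ≡ true → I p l ≡ true → I x l ≡ true → Q l ≡ true) →
    count (λ x → I x ℓ ∧ R x) ≤ count (λ l → I p l ∧ Q l)
  points-on-line≤lines-through-point = lines-through-point≤points-on-line (dual Π)

module _ {k np nl} (Π : ProjectivePlane (1 + 2 * k) np nl) where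
  open ProjectivePlane Π

  line-size-halves : ∀ m → count (λ x → I x m) ≡ suc k + suc k
  line-size-halves m = trans (line-size m) (order≡twice k)

  all-on-line⇒≥ : ∀ {m} {F : Fin np → Bool} → (∀ x → I x m ≡ true → F x ≡ true) →
    suc k ≤ count (λ x → I x m ∧ F x)
  all-on-line⇒≥ {m} {F} all = begin
    suc k                      ≤⟨ m≤m+n (suc k) (suc k) ⟩
    suc k + suc k              ≡⟨ sym (line-size-halves m) ⟩
    count (λ x → I x m)        ≤⟨ count-mono (λ x xm → cong₂ _∧_ xm (all x xm)) ⟩
    count (λ x → I x m ∧ F x)  ∎
    where open ≤-Reasoning

  few-on-line⇒many-off : ∀ {m} {F : Fin np → Bool} → count (λ x → I x m ∧ F x) ≤ suc k →
    suc k ≤ count (λ x → I x m ∧ not (F x))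
  few-on-line⇒many-off {m} = count-∧-not-≥ (λ x → I x m) _ (line-size-halves m)

module _ {k np nl} (Π : ProjectivePlane (1 + 2 * k) np nl) where
  open ProjectivePlane Π

  all-through-point⇒≥ : ∀ {p} {F : Fin nl → Bool} → (∀ l → I p l ≡ true → F l ≡ true) →
    suc k ≤ count (λ l → I p l ∧ F l)
  all-through-point⇒≥ = all-on-line⇒≥ (dual Π)

  few-through-point⇒many-off : ∀ {p} {F : Fin nl → Bool} → count (λ l → I p l ∧ F l) ≤ suc k →
    suc k ≤ count (λ l → I p l ∧ not (F l))
  few-through-point⇒many-off = few-on-line⇒many-off (dual Π)

module _ {q np nl} (Π : ProjectivePlane q np nl) where
  open ProjectivePlane Π

  private
    G : Graph (np + nl)
    G = incidenceGraph Π

  data VertexView : Fin (np + nl) → Set where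
    point : ∀ p → VertexView (p ↑ˡ nl)
    line  : ∀ l → VertexView (np ↑ʳ l)

  vertexView : ∀ v → VertexView v
  vertexView v with splitAt np v in e
  ... | inj₁ p = subst VertexView (splitAt⁻¹-↑ˡ e) (point p)
  ... | inj₂ l = subst VertexView (splitAt⁻¹-↑ʳ e) (line l)

  incAdj-point-point : ∀ p x → incAdj Π (p ↑ˡ nl) (x ↑ˡ nl) ≡ false
  incAdj-point-point p x rewrite splitAt-↑ˡ np p nl | splitAt-↑ˡ np x nl = refl

  incAdj-point-line : ∀ p l → incAdj Π (p ↑ˡ nl) (np ↑ʳ l) ≡ I p l
  incAdj-point-line p l rewrite splitAt-↑ˡ np p nl | splitAt-↑ʳ np nl l = refl

  incAdj-line-point : ∀ l p → incAdj Π (np ↑ʳ l) (p ↑ˡ nl) ≡ I p l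
  incAdj-line-point l p rewrite splitAt-↑ˡ np p nl | splitAt-↑ʳ np nl l = refl

  incAdj-line-line : ∀ l m → incAdj Π (np ↑ʳ l) (np ↑ʳ m) ≡ false
  incAdj-line-line l m rewrite splitAt-↑ʳ np nl l | splitAt-↑ʳ np nl m = refl

  vertexSet-point : ∀ S T p → vertexSet Π S T (p ↑ˡ nl) ≡ S p
  vertexSet-point S T p rewrite splitAt-↑ˡ np p nl = refl

  vertexSet-line : ∀ S T l → vertexSet Π S T (np ↑ʳ l) ≡ T l
  vertexSet-line S T l rewrite splitAt-↑ʳ np nl l = refl

  degIn-point : ∀ U p → degIn G U (p ↑ˡ nl) ≡ count (λ l → I p l ∧ U (np ↑ʳ l))
  degIn-point U p = trans (count-+ {np} {nl} _) (cong₂ _+_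
    (trans (count-cong λ x → cong (_∧ U (x ↑ˡ nl)) (incAdj-point-point p x)) (count-false {np}))
    (count-cong λ l → cong (_∧ U (np ↑ʳ l)) (incAdj-point-line p l)))

  degIn-line : ∀ U l → degIn G U (np ↑ʳ l) ≡ count (λ p → I p l ∧ U (p ↑ˡ nl))
  degIn-line U l = trans (count-+ {np} {nl} _) (trans (cong₂ _+_
    (count-cong λ p → cong (_∧ U (p ↑ˡ nl)) (incAdj-line-point l p))
    (trans (count-cong λ m → cong (_∧ U (np ↑ʳ m)) (incAdj-line-line l m)) (count-false {nl})))
    (+-identityʳ _))

  deg≡degIn-all : ∀ v → deg G v ≡ degIn G (λ _ → true) v
  deg≡degIn-all v = count-cong λ u → sym (∧-identityʳ (incAdj Π v u))

  deg-point : ∀ p → deg G (p ↑ˡ nl) ≡ suc q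
  deg-point p = trans (deg≡degIn-all _) (trans (degIn-point _ p)
    (trans (count-cong λ l → ∧-identityʳ (I p l)) (point-deg p)))

  deg-line : ∀ l → deg G (np ↑ʳ l) ≡ suc q
  deg-line l = trans (deg≡degIn-all _) (trans (degIn-line _ l)
    (trans (count-cong λ p → ∧-identityʳ (I p l)) (line-size l)))

  point-internal : ∀ U p {F : Fin nl → Bool} → (∀ l → U (np ↑ʳ l) ≡ F l) →
    suc q ≤ 2 * count (λ l → I p l ∧ F l) → deg G (p ↑ˡ nl) ≤ 2 * degIn G U (p ↑ˡ nl)
  point-internal U p U≗F half = subst₂ _≤_ (sym (deg-point p))
    (cong (2 *_) (sym (trans (degIn-point U p) (count-cong λ l → cong (I p l ∧_) (U≗F l))))) half

  line-internal : ∀ U l {F : Fin np → Bool} → (∀ p → U (p ↑ˡ nl) ≡ F p) →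
    suc q ≤ 2 * count (λ p → I p l ∧ F p) → deg G (np ↑ʳ l) ≤ 2 * degIn G U (np ↑ʳ l)
  line-internal U l U≗F half = subst₂ _≤_ (sym (deg-line l))
    (cong (2 *_) (sym (trans (degIn-line U l) (count-cong λ p → cong (I p l ∧_) (U≗F p))))) half

  vertexSet-isInternalPartition : (S : Fin np → Bool) (T : Fin nl → Bool) →
    (∃ λ p → S p ≡ true) → (∃ λ p → S p ≡ false) →
    (∀ p → S p ≡ true  → suc q ≤ 2 * count (λ l → I p l ∧ T l)) →
    (∀ p → S p ≡ false → suc q ≤ 2 * count (λ l → I p l ∧ not (T l))) →
    (∀ l → T l ≡ true  → suc q ≤ 2 * count (λ p → I p l ∧ S p)) →
    (∀ l → T l ≡ false → suc q ≤ 2 * count (λ p → I p l ∧ not (S p))) →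
    IsInternalPartition G (vertexSet Π S T)
  vertexSet-isInternalPartition S T (a , Sa) (b , ¬Sb) pointA pointB lineA lineB =
    (a ↑ˡ nl , trans (vertexSet-point S T a) Sa) , (b ↑ˡ nl , trans (vertexSet-point S T b) ¬Sb) , inA , inB
    where
      V : Fin (np + nl) → Bool
      V = vertexSet Π S T
      Vᶜ : Fin (np + nl) → Bool
      Vᶜ u = if V u then false else true
      Vᶜ-point : ∀ p → Vᶜ (p ↑ˡ nl) ≡ not (S p)
      Vᶜ-point p = trans (cong (λ b → if b then false else true) (vertexSet-point S T p))
        (if-then-false-else-true≡not _)
      Vᶜ-line : ∀ l → Vᶜ (np ↑ʳ l) ≡ not (T l)
      Vᶜ-line l = trans (cong (λ b → if b then false else true) (vertexSet-line S T l))
        (if-then-false-else-true≡not _)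

      inA : ∀ v → V v ≡ true → deg G v ≤ 2 * degIn G V v
      inA v with vertexView v
      ... | point p = point-internal V p (vertexSet-line S T) ∘ pointA p ∘ trans (sym (vertexSet-point S T p))
      ... | line l  = line-internal V l (vertexSet-point S T) ∘ lineA l ∘ trans (sym (vertexSet-line S T l))

      inB : ∀ v → V v ≡ false → deg G v ≤ 2 * degIn G Vᶜ v
      inB v with vertexView v
      ... | point p = point-internal Vᶜ p Vᶜ-line ∘ pointB p ∘ trans (sym (vertexSet-point S T p))
      ... | line l  = line-internal Vᶜ l Vᶜ-point ∘ lineB l ∘ trans (sym (vertexSet-line S T l))

module Configuration {k np nl : ℕ} (Π : ProjectivePlane (1 + 2 * k) np nl) (P : Fin np) (S : Fin nl → Bool)
  (S-through-P : ∀ l → S l ≡ true → ProjectivePlane.I Π P l ≡ true) (∣S∣ : count S ≡ suc k)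
  (ℓ : Fin nl) (P∉ℓ : ProjectivePlane.I Π P ℓ ≡ false) where
  open ProjectivePlane Π

  P₁ : Fin np → Bool
  P₁ p = anyFin (λ l → S l ∧ I p l)

  L₁ : Fin nl → Bool
  L₁ m = anyFin (λ p → P₁ p ∧ (I p ℓ ∧ I p m))

  P₁⁺ : ∀ {x s} → S s ≡ true → I x s ≡ true → P₁ x ≡ true
  P₁⁺ {s = s} Ss xs = anyFin⁺ _ s (cong₂ _∧_ Ss xs)

  P₁⁻ : ∀ {x} → P₁ x ≡ true → ∃ λ s → S s ≡ true × I x s ≡ true
  P₁⁻ {x} x∈P₁ with anyFin⁻ (λ s → S s ∧ I x s) x∈P₁
  ... | s , h = s , ∧-conicalˡ _ _ h , ∧-conicalʳ _ _ h

  L₁⁺ : ∀ {x m} → P₁ x ≡ true → I x ℓ ≡ true → I x m ≡ true → L₁ m ≡ true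
  L₁⁺ {x} x∈P₁ xℓ xm = anyFin⁺ _ x (cong₂ _∧_ x∈P₁ (cong₂ _∧_ xℓ xm))

  L₁⁻ : ∀ {m} → L₁ m ≡ true → ∃ λ x → P₁ x ≡ true × I x ℓ ≡ true × I x m ≡ true
  L₁⁻ {m} m∈L₁ with anyFin⁻ (λ x → P₁ x ∧ (I x ℓ ∧ I x m)) m∈L₁
  ... | x , h = x , ∧-conicalˡ (P₁ x) _ h , ∧-conicalˡ (I x ℓ) _ xℓ∧xm , ∧-conicalʳ (I x ℓ) _ xℓ∧xm
    where
      xℓ∧xm : I x ℓ ∧ I x m ≡ true
      xℓ∧xm = ∧-conicalʳ (P₁ x) _ h

  ∣S∣-through-P : count (λ s → I P s ∧ S s) ≡ suc k
  ∣S∣-through-P = trans (count-cong S-through-P∧) ∣S∣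
    where
      S-through-P∧ : ∀ s → I P s ∧ S s ≡ S s
      S-through-P∧ s with S s in Ss
      ... | true  = trans (∧-identityʳ (I P s)) (S-through-P s Ss)
      ... | false = ∧-zeroʳ (I P s)

  P∈P₁ : P₁ P ≡ true
  P∈P₁ with count-witness S (subst (0 <_) (sym ∣S∣) (s≤s z≤n))
  ... | s , Ss = P₁⁺ Ss (S-through-P s Ss)

  P₁-join : ∀ {x l} → P ≢ x → P₁ x ≡ true → I P l ≡ true → I x l ≡ true → S l ≡ true
  P₁-join P≢x x∈P₁ Pl xl with P₁⁻ x∈P₁
  ... | s , Ss , xs = subst (λ m → S m ≡ true) (join-unique Π P≢x (S-through-P s Ss) xs Pl xl) Ss

  S⇒L₁ : ∀ {m} → S m ≡ true → L₁ m ≡ true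
  S⇒L₁ {m} Sm = L₁⁺ (P₁⁺ Sm meet∈m) (meet-incidentʳ Π m ℓ m≢ℓ) meet∈m
    where
      m≢ℓ : m ≢ ℓ
      m≢ℓ = separated⇒≢ (I P) (S-through-P m Sm) P∉ℓ
      meet∈m : I (meet Π m ℓ m≢ℓ) m ≡ true
      meet∈m = meet-incidentˡ Π m ℓ m≢ℓ

  L₁-through-P⇒S : ∀ {m} → I P m ≡ true → L₁ m ≡ true → S m ≡ true
  L₁-through-P⇒S Pm m∈L₁ with L₁⁻ m∈L₁
  ... | x , x∈P₁ , xℓ , xm = P₁-join (≢-sym (separated⇒≢ (λ y → I y ℓ) xℓ P∉ℓ)) x∈P₁ Pm xm

  L₁-meets-ℓ-in-P₁ : ∀ {l y} → l ≢ ℓ → L₁ l ≡ true → I y l ≡ true → I y ℓ ≡ true → P₁ y ≡ true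
  L₁-meets-ℓ-in-P₁ l≢ℓ l∈L₁ yl yℓ with L₁⁻ l∈L₁
  ... | x , x∈P₁ , xℓ , xl = subst (λ z → P₁ z ≡ true) (meet-unique Π l≢ℓ xl xℓ yl yℓ) x∈P₁

  P₁-on-line-≥ : ∀ {m} → I P m ≡ false → suc k ≤ count (λ x → I x m ∧ P₁ x)
  P₁-on-line-≥ P∉m = ≤-trans (≤-reflexive (sym ∣S∣-through-P))
    (lines-through-point≤points-on-line Π P∉m S P₁ λ s x _ Ss _ xs → P₁⁺ Ss xs)

  P₁-free-on-line-≥ : ∀ {m} → I P m ≡ false → suc k ≤ count (λ x → I x m ∧ not (P₁ x))
  P₁-free-on-line-≥ {m} P∉m = few-on-line⇒many-off Π (≤-trans
    (points-on-line≤lines-through-point Π P∉m P₁ S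
      λ x l xm x∈P₁ Pl xl → P₁-join (≢-sym (separated⇒≢ (λ y → I y m) xm P∉m)) x∈P₁ Pl xl)
    (≤-reflexive ∣S∣-through-P))

  P₁-free-point : ∃ λ x → P₁ x ≡ false
  P₁-free-point with count-witness _ (≤-trans (s≤s z≤n) (P₁-free-on-line-≥ P∉ℓ))
  ... | x , h = x , not-≡-true⇒≡-false (∧-conicalʳ _ _ h)

  line-in-A : ∀ m → L₁ m ≡ true → suc k ≤ count (λ x → I x m ∧ P₁ x)
  line-in-A m m∈L₁ with I P m in Pm
  ... | false = P₁-on-line-≥ Pm
  ... | true  = all-on-line⇒≥ Π λ x xm → P₁⁺ (L₁-through-P⇒S Pm m∈L₁) xm

  line-in-B : ∀ m → L₁ m ≡ false → suc k ≤ count (λ x → I x m ∧ not (P₁ x))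
  line-in-B m m∉L₁ with I P m in Pm
  ... | false = P₁-free-on-line-≥ Pm
  ... | true  = few-on-line⇒many-off Π (≤-trans (count-≤1 _ P only-P) (s≤s z≤n))
    where
      only-P : ∀ x → I x m ∧ P₁ x ≡ true → x ≡ P
      only-P x h with x ≟ P
      ... | yes x≡P = x≡P
      ... | no  x≢P = contradiction m∉L₁
        (not-¬ (S⇒L₁ (P₁-join (≢-sym x≢P) (∧-conicalʳ _ _ h) Pm (∧-conicalˡ _ _ h))))

  point-in-A : ∀ p → P₁ p ≡ true → suc k ≤ count (λ l → I p l ∧ L₁ l)
  point-in-A p p∈P₁ with I p ℓ in pℓ
  ... | true  = all-through-point⇒≥ Π λ l pl → L₁⁺ p∈P₁ pℓ pl
  ... | false = ≤-trans (P₁-on-line-≥ P∉ℓ)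
    (points-on-line≤lines-through-point Π pℓ P₁ L₁ λ x l xℓ x∈P₁ _ xl → L₁⁺ x∈P₁ xℓ xl)

  point-in-B : ∀ p → P₁ p ≡ false → suc k ≤ count (λ l → I p l ∧ not (L₁ l))
  point-in-B p p∉P₁ with I p ℓ in pℓ
  ... | true  = few-through-point⇒many-off Π (≤-trans (count-≤1 _ ℓ only-ℓ) (s≤s z≤n))
    where
      only-ℓ : ∀ l → I p l ∧ L₁ l ≡ true → l ≡ ℓ
      only-ℓ l h with l ≟ ℓ
      ... | yes l≡ℓ = l≡ℓ
      ... | no  l≢ℓ = contradiction p∉P₁
        (not-¬ (L₁-meets-ℓ-in-P₁ l≢ℓ (∧-conicalʳ _ _ h) (∧-conicalˡ _ _ h) pℓ))
  ... | false = ≤-trans (P₁-free-on-line-≥ P∉ℓ)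
    (points-on-line≤lines-through-point Π pℓ (not ∘ P₁) (not ∘ L₁) joins-outside-L₁)
    where
      joins-outside-L₁ : ∀ x l → I x ℓ ≡ true → not (P₁ x) ≡ true → I p l ≡ true → I x l ≡ true →
        not (L₁ l) ≡ true
      joins-outside-L₁ x l xℓ x∉P₁ pl xl = not-≡-true λ l∈L₁ → contradiction (not-≡-true⇒≡-false x∉P₁)
        (not-¬ (L₁-meets-ℓ-in-P₁ (separated⇒≢ (I p) pl pℓ) l∈L₁ xl xℓ))

mainTheorem2 : (k np nl : ℕ) (Π : ProjectivePlane (1 + 2 * k) np nl) →
  let open ProjectivePlane Π in
  (P : Fin np) (S : Fin nl → Bool) →
  (∀ l → S l ≡ true → I P l ≡ true) →
  count S ≡ suc k →
  (ℓ : Fin nl) → I P ℓ ≡ false →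
  let P₁ = λ p → anyFin (λ l → S l ∧ I p l)
      L₁ = λ m → anyFin (λ p → P₁ p ∧ (I p ℓ ∧ I p m))
  in IsInternalPartition (incidenceGraph Π) (vertexSet Π P₁ L₁)
mainTheorem2 k np nl Π P S S-through-P ∣S∣ ℓ P∉ℓ =
  vertexSet-isInternalPartition Π P₁ L₁ (P , P∈P₁) P₁-free-point
    (λ p → majority ∘ point-in-A p) (λ p → majority ∘ point-in-B p)
    (λ m → majority ∘ line-in-A m) (λ m → majority ∘ line-in-B m)
  where open Configuration Π P S S-through-P ∣S∣ ℓ P∉ℓ
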